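{- Two unrooted binary trees on the same set of $n$ taxa precisely satisfy at most $(n-3)$-interval cospeciation; i.e. $\max_{A,B}\lvert\varepsilon_{T_1}(A,B)-\varepsilon_{T_2}(A,B)\rvert\le n-3$.
   Context: An unrooted binary tree is a tree in which every non-leaf vertex has degree three, with leaves labeled by taxa. $\varepsilon_T(A,B)$ is the number of edges on the path between taxa $A$ and $B$ in $T$. Two trees satisfy $k$-interval cospeciation ($k$-IC) if $\lvert \varepsilon_{T_1}(A,B)-\varepsilon_{T_2}(A,B)\rvert\le k$ for all pairs of taxa $A,B$; they precisely satisfy $k$-IC if they satisfy $k$-IC but not $(k-1)$-IC. -}

module Defs where

open import Data.Nat using (ℕ; zero; suc; _≤_; _∸_; ∣_-_∣)
open import Data.Fin using (Fin)
open import Data.Bool using (Bool; true; false; if_then_else_)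
open import Data.List using (List; []; _∷_; map)
open import Data.Nat.ListAction using (sum)
open import Data.Empty using (⊥)
open import Data.List.Base using (allFin)
open import Data.List.Relation.Unary.Unique.Propositional using (Unique)
open import Data.Product using (Σ; ∃; _×_; _,_)
open import Data.Sum using (_⊎_)
open import Function.Definitions using (Injective)
open import Relation.Binary.PropositionalEquality using (_≡_)
open import Relation.Nullary using (¬_)

degree : {m : ℕ} → (Fin m → Fin m → Bool) → Fin m → ℕ
degree {m} adj v = sum (map (λ w → if adj v w then 1 else 0) (allFin m))

data Walk {m : ℕ} (adj : Fin m → Fin m → Bool) : Fin m → Fin m → ℕ → Set where
  here : ∀ {u} → Walk adj u u 0
  step : ∀ {u w v k} → adj u w ≡ true → Walk adj w v k → Walk adj u v (suc k)

vertices : ∀ {m} {adj : Fin m → Fin m → Bool} {u v k} → Walk adj u v k → List (Fin m)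
vertices {u = u} here = u ∷ []
vertices {u = u} (step _ p) = u ∷ vertices p

IsPath : ∀ {m} {adj : Fin m → Fin m → Bool} {u v k} → Walk adj u v k → Set
IsPath p = Unique (vertices p)

-- a cycle: closed walk u → u with ≥ 3 edges whose vertices (listing u once) are distinct
IsCycle : ∀ {m} {adj : Fin m → Fin m → Bool} {u k} → Walk adj u u k → Set
IsCycle here = ⊥
IsCycle {k = k} (step _ p) = (3 ≤ k) × Unique (vertices p)

record UnrootedBinaryTree (n : ℕ) : Set where
  field
    m         : ℕ
    adj       : Fin m → Fin m → Bool
    irrefl    : ∀ v → adj v v ≡ false
    sym       : ∀ u v → adj u v ≡ adj v u
    connected : ∀ u v → ∃ λ k → Walk adj u v k
    acyclic   : ∀ u k (c : Walk adj u u k) → ¬ IsCycle c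
    leaf      : Fin n → Fin m
    leaf-inj  : Injective _≡_ _≡_ leaf
    leaf-deg  : ∀ i → degree adj (leaf i) ≤ 1
    internal  : ∀ v → degree adj v ≡ 3 ⊎ (∃ λ i → leaf i ≡ v)

open UnrootedBinaryTree public

-- ε_T(A,B) = d : the path between taxa A and B in T has d edges
-- (in a tree this path exists and is unique)
ε≡ : ∀ {n} → UnrootedBinaryTree n → Fin n → Fin n → ℕ → Set
ε≡ T A B d = Σ (Walk (adj T) (leaf T A) (leaf T B) d) IsPath

IC : ∀ {n} → ℕ → UnrootedBinaryTree n → UnrootedBinaryTree n → Set
IC {n} k T₁ T₂ = ∀ (A B : Fin n) (d₁ d₂ : ℕ) → ε≡ T₁ A B d₁ → ε≡ T₂ A B d₂ → ∣ d₁ - d₂ ∣ ≤ k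

module Submission where

-- For distinct taxa A ≠ B, let d be the number of edges of the path between
-- their leaves in a tree T.  We show 1 ≤ d ≤ n ∸ 1, and 2 ≤ d when n ≥ 3;
-- two numbers in an interval of width n ∸ 3 differ by at most n ∸ 3.
--   * Upper bound.  Each inner vertex x of the path has a third neighbour off
--     the path; walking on from it without ever turning back must end at a
--     leaf, because a non-backtracking walk in a tree is a path.  Since
--     non-backtracking walks between two vertices are unique, the d ∸ 1
--     leaves found this way are distinct from each other and from A and B,
--     so d + 1 ≤ n.
--   * Lower bound.  If the leaves of A and B were adjacent, no walk could
--     leave {A, B}, so a third taxon would be unreachable.

open import Defs
open import Data.Bool using (Bool; true; false; if_then_else_)
open import Data.Bool.Properties using (T-≡)
open import Data.Fin as Fin using (Fin) renaming (_≟_ to _≟ᶠ_)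
open import Data.List using (List; []; _∷_; length; map; head; allFin; filterᵇ)
open import Data.List.Membership.Propositional using (_∈_; _∉_; find; lose)
open import Data.List.Membership.Propositional.Properties using (∈-allFin; ∈-filter⁺; ∈-filter⁻)
open import Data.List.Properties using (length-tabulate; ∷-injectiveʳ)
open import Data.List.Relation.Binary.Subset.Propositional using (_⊆_)
open import Data.List.Relation.Unary.All as All using (All; []; _∷_)
open import Data.List.Relation.Unary.All.Properties using (¬Any⇒All¬)
open import Data.List.Relation.Unary.AllPairs using ([]; _∷_)
open import Data.List.Relation.Unary.Any using (here; there; any?)
open import Data.List.Relation.Unary.Unique.Propositional using (Unique)
open import Data.List.Relation.Unary.Unique.Propositional.Properties using (allFin⁺; filter⁺)
open import Data.Maybe using (just)
open import Data.Maybe.Properties using (just-injective)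
open import Data.Nat using (ℕ; zero; suc; _+_; _≤_; _∸_; ∣_-_∣; z≤n; s≤s; s≤s⁻¹)
open import Data.Nat.ListAction using (sum)
open import Data.Nat.Properties using (≤-trans; <-irrefl; m≤m+n; +-suc; ∣m-n∣≤m⊔n; ⊔-lub)
open import Data.Product using (Σ; ∃; _×_; _,_; proj₂)
open import Data.Sum using (_⊎_; inj₁; inj₂)
open import Data.Unit using (⊤; tt)
open import Function using (_∘_)
open import Function.Bundles using (Equivalence)
open import Relation.Binary.Definitions using (DecidableEquality)
open import Relation.Binary.PropositionalEquality using (_≡_; _≢_; refl; trans; cong; subst; subst₂; module ≡-Reasoning) renaming (sym to ≡-sym)
open import Relation.Nullary using (yes; no; contradiction; ¬?)
open import Relation.Nullary.Decidable using (T?; _×-dec_)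

module _ {A : Set} where

  delete-one : ∀ {x : A} ys → x ∈ ys →
               ∃ λ ys′ → length ys ≡ suc (length ys′) × (∀ {z} → z ∈ ys → z ≢ x → z ∈ ys′)
  delete-one (y ∷ ys) (here refl) =
    ys , refl , λ { (here refl) z≢x → contradiction refl z≢x ; (there z∈ys) _ → z∈ys }
  delete-one (y ∷ ys) (there x∈ys) with ys′ , len , keep ← delete-one ys x∈ys =
    y ∷ ys′ , cong suc len , λ { (here refl) _ → here refl ; (there z∈ys) z≢x → there (keep z∈ys z≢x) }

  unique-⊆⇒length-≤ : ∀ {xs ys : List A} → Unique xs → xs ⊆ ys → length xs ≤ length ys
  unique-⊆⇒length-≤ {[]} _ _ = z≤n
  unique-⊆⇒length-≤ {x ∷ xs} {ys} (x≢xs ∷ xs-unique) x∷xs⊆ys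
    with ys′ , len , keep ← delete-one ys (x∷xs⊆ys (here refl)) =
    subst (_ ≤_) (≡-sym len)
      (s≤s (unique-⊆⇒length-≤ xs-unique λ z∈xs →
        keep (x∷xs⊆ys (there z∈xs)) (λ z≡x → All.lookup x≢xs z∈xs (≡-sym z≡x))))

  avoid-two : DecidableEquality A → ∀ {xs : List A} → Unique xs → 3 ≤ length xs →
              (a b : A) → ∃ λ t → t ∈ xs × t ≢ a × t ≢ b
  avoid-two _≟_ {xs} xs-unique 3≤length a b with any? (λ t → ¬? (t ≟ a) ×-dec ¬? (t ≟ b)) xs
  ... | yes found with t , t∈xs , t≢a , t≢b ← find found = t , t∈xs , t≢a , t≢b
  ... | no none = contradiction (≤-trans 3≤length (unique-⊆⇒length-≤ xs-unique xs⊆ab)) (<-irrefl refl)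
    where
      xs⊆ab : xs ⊆ a ∷ b ∷ []
      xs⊆ab {t} t∈xs with t ≟ a | t ≟ b
      ... | yes refl | _        = here refl
      ... | no _     | yes refl = there (here refl)
      ... | no t≢a   | no t≢b   = contradiction (lose t∈xs (t≢a , t≢b)) none

  sum-indicator≡length-filter : (f : A → Bool) (xs : List A) →
                                sum (map (λ w → if f w then 1 else 0) xs) ≡ length (filterᵇ f xs)
  sum-indicator≡length-filter f [] = refl
  sum-indicator≡length-filter f (x ∷ xs) with f x
  ... | true  = cong suc (sum-indicator≡length-filter f xs)
  ... | false = sum-indicator≡length-filter f xs

length-allFin : ∀ k → length (allFin k) ≡ k
length-allFin k = length-tabulate (λ i → i)

module Neighbourhood {m : ℕ} (adj : Fin m → Fin m → Bool) where

  neighbours : Fin m → List (Fin m)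
  neighbours x = filterᵇ (adj x) (allFin m)

  degree≡length-neighbours : ∀ x → degree adj x ≡ length (neighbours x)
  degree≡length-neighbours x = sum-indicator≡length-filter (adj x) (allFin m)

  ∈-neighbours⁺ : ∀ {x y} → adj x y ≡ true → y ∈ neighbours x
  ∈-neighbours⁺ {x} {y} xy = ∈-filter⁺ (T? ∘ adj x) (∈-allFin y) (Equivalence.from T-≡ xy)

  ∈-neighbours⁻ : ∀ {x y} → y ∈ neighbours x → adj x y ≡ true
  ∈-neighbours⁻ {x} y∈ = Equivalence.to T-≡ (proj₂ (∈-filter⁻ (T? ∘ adj x) {xs = allFin m} y∈))

  neighbours-unique : ∀ x → Unique (neighbours x)
  neighbours-unique x = filter⁺ (T? ∘ adj x) (allFin⁺ m)

  two-neighbours⇒2≤degree : ∀ {x y z} → adj x y ≡ true → adj x z ≡ true → y ≢ z → 2 ≤ degree adj x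
  two-neighbours⇒2≤degree {x} xy xz y≢z =
    subst (2 ≤_) (≡-sym (degree≡length-neighbours x))
      (unique-⊆⇒length-≤ ((y≢z ∷ []) ∷ [] ∷ [])
        λ { (here refl) → ∈-neighbours⁺ xy ; (there (here refl)) → ∈-neighbours⁺ xz })

  third-neighbour : ∀ {x} → degree adj x ≡ 3 → (a b : Fin m) → ∃ λ t → adj x t ≡ true × t ≢ a × t ≢ b
  third-neighbour {x} deg≡3 a b
    with t , t∈ , t≢a , t≢b ← avoid-two _≟ᶠ_ (neighbours-unique x)
           (subst (3 ≤_) (trans (≡-sym deg≡3) (degree≡length-neighbours x)) (s≤s (s≤s (s≤s z≤n)))) a b
    = t , ∈-neighbours⁻ t∈ , t≢a , t≢b

module Walks {m : ℕ} {adj : Fin m → Fin m → Bool} where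

  length-vertices : ∀ {u v k} (p : Walk adj u v k) → length (vertices p) ≡ suc k
  length-vertices here       = refl
  length-vertices (step _ p) = cong suc (length-vertices p)

  head-vertices : ∀ {u v k} (p : Walk adj u v k) → head (vertices p) ≡ just u
  head-vertices here       = refl
  head-vertices (step _ p) = refl

  start∈vertices : ∀ {u v k} (p : Walk adj u v k) → u ∈ vertices p
  start∈vertices here       = here refl
  start∈vertices (step _ p) = here refl

  end∈vertices : ∀ {u v k} (p : Walk adj u v k) → v ∈ vertices p
  end∈vertices here       = here refl
  end∈vertices (step _ p) = there (end∈vertices p)

  distinct⇒1≤length : ∀ {u v k} → u ≢ v → Walk adj u v k → 1 ≤ k
  distinct⇒1≤length u≢u here      = contradiction refl u≢u
  distinct⇒1≤length _   (step _ _) = s≤s z≤n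

  walk-of-length-1 : ∀ {u v} → Walk adj u v 1 → adj u v ≡ true
  walk-of-length-1 (step uv here) = uv

  -- A path with k edges visits k + 1 distinct vertices, so k < m.
  path-length<m : ∀ {u v k} (p : Walk adj u v k) → IsPath p → suc k ≤ m
  path-length<m p p-path =
    subst₂ _≤_ (length-vertices p) (length-allFin _)
      (unique-⊆⇒length-≤ p-path (λ {z} _ → ∈-allFin z))

  closed-path-trivial : ∀ {u k} (p : Walk adj u u k) → IsPath p → k ≡ 0
  closed-path-trivial here       _         = refl
  closed-path-trivial (step _ p) (u∉p ∷ _) = contradiction refl (All.lookup u∉p (end∈vertices p))

  path-prefix : ∀ {w v k u} (p : Walk adj w v k) → IsPath p → u ∈ vertices p →
                ∃ λ j → Σ (Walk adj w u j) λ q → IsPath q × vertices q ⊆ vertices p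
  path-prefix here _ (here refl) = 0 , here , [] ∷ [] , λ z∈ → z∈
  path-prefix (step _ p) _ (here refl) = 0 , here , [] ∷ [] , λ { (here refl) → here refl }
  path-prefix (step e p) (w∉p ∷ p-path) (there u∈p)
    with j , q , q-path , q⊆p ← path-prefix p p-path u∈p =
    suc j , step e q , All.tabulate (λ z∈q → All.lookup w∉p (q⊆p z∈q)) ∷ q-path ,
    λ { (here refl) → here refl ; (there z∈q) → there (q⊆p z∈q) }

  FirstStepAvoids : ∀ {x y k} → Fin m → Walk adj x y k → Set
  FirstStepAvoids a here               = ⊤
  FirstStepAvoids a (step {w = w} _ _) = a ≢ w

  NonBacktracking : ∀ {x y k} → Walk adj x y k → Set
  NonBacktracking here               = ⊤
  NonBacktracking (step {u = u} _ p) = FirstStepAvoids u p × NonBacktracking p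

  path⇒nonBacktracking : ∀ {u v k} (p : Walk adj u v k) → IsPath p → NonBacktracking p
  path⇒nonBacktracking here                 _                    = tt
  path⇒nonBacktracking (step _ here)        _                    = tt , tt
  path⇒nonBacktracking (step _ (step e p)) ((_ ∷ u∉p) ∷ p-path) =
    (λ { refl → All.lookup u∉p (start∈vertices p) refl }) , path⇒nonBacktracking (step e p) p-path

module Tree {n : ℕ} (T : UnrootedBinaryTree n) where

  open Neighbourhood (adj T)
  open Walks {adj = adj T}

  V : Set
  V = Fin (m T)

  G : V → V → Bool
  G = adj T

  adjacent⇒≢ : ∀ {u w} → G u w ≡ true → u ≢ w
  adjacent⇒≢ {u} uw refl = contradiction (trans (≡-sym uw) (irrefl T u)) λ ()

  -- After the step u → w, a non-backtracking path from w never revisits u: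
  -- u, w, the next vertex and the segment back to u would form a cycle.
  not-revisited : ∀ {u w v k} → G u w ≡ true → (p : Walk G w v k) →
                  FirstStepAvoids u p → IsPath p → u ∉ vertices p
  not-revisited uw here       _ _ (here refl) = adjacent⇒≢ uw refl
  not-revisited uw (step _ p) _ _ (here refl) = adjacent⇒≢ uw refl
  not-revisited {u} uw (step ww′ p) u≢w′ (w∉p ∷ p-path) (there u∈p)
    with j , q , q-path , q⊆p ← path-prefix p p-path u∈p =
    acyclic T u _ (step uw (step ww′ q))
      ( s≤s (s≤s (distinct⇒1≤length (u≢w′ ∘ ≡-sym) q))
      , All.tabulate (λ z∈q → All.lookup w∉p (q⊆p z∈q)) ∷ q-path)

  nonBacktracking⇒path : ∀ {u v k} (p : Walk G u v k) → NonBacktracking p → IsPath p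
  nonBacktracking⇒path here       _               = [] ∷ []
  nonBacktracking⇒path (step uw p) (u-avoids , p-nb) =
    ¬Any⇒All¬ (vertices p) (not-revisited uw p u-avoids p-path) ∷ p-path
    where
      p-path : IsPath p
      p-path = nonBacktracking⇒path p p-nb

  -- If the first steps x → w₁ of the walk and x → w₂ of the path
  -- differed, w₂ → x → w₁ → ⋯ would be a non-backtracking walk with the same
  -- ends as the rest of the path, hence (by induction) visit only its
  -- vertices; but it visits x, which the rest of the path avoids.
  path-unique : ∀ {x y k k′} (q : Walk G x y k) → IsPath q →
                (p : Walk G x y k′) → NonBacktracking p → vertices p ≡ vertices q
  path-unique here _ here _ = refl
  path-unique here _ (step xw p) p-nb =
    contradiction (closed-path-trivial (step xw p) (nonBacktracking⇒path (step xw p) p-nb)) λ ()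
  path-unique (step xw q) q-path here _ =
    contradiction (closed-path-trivial (step xw q) q-path) λ ()
  path-unique {y = y} (step {w = w₂} xw₂ q) (x∉q ∷ q-path) (step {u = x} {w = w₁} xw₁ p) (x-avoids , p-nb)
    with w₁ ≟ᶠ w₂
  ... | yes refl = cong (x ∷_) (path-unique q q-path p p-nb)
  ... | no w₁≢w₂ = contradiction refl (All.lookup x∉q (subst (x ∈_) detour≡q (there (here refl))))
    where
      detour : Walk G w₂ y _
      detour = step (trans (sym T w₂ x) xw₂) (step xw₁ p)

      detour≡q : vertices detour ≡ vertices q
      detour≡q = path-unique q q-path detour (w₁≢w₂ ∘ ≡-sym , x-avoids , p-nb)

  same-first-step : ∀ {x w w′ y k k′} (xw : G x w ≡ true) (p : Walk G w y k)
                    (xw′ : G x w′ ≡ true) (p′ : Walk G w′ y k′) →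
                    NonBacktracking (step xw p) → NonBacktracking (step xw′ p′) → w ≡ w′
  same-first-step {w = w} {w′} xw p xw′ p′ nb nb′ = just-injective (begin
    just w             ≡⟨ head-vertices p ⟨
    head (vertices p)  ≡⟨ cong head (∷-injectiveʳ same-vertices) ⟩
    head (vertices p′) ≡⟨ head-vertices p′ ⟩
    just w′            ∎)
    where
      open ≡-Reasoning
      same-vertices : vertices (step xw p) ≡ vertices (step xw′ p′)
      same-vertices = path-unique (step xw′ p′) (nonBacktracking⇒path (step xw′ p′) nb′) (step xw p) nb

  leaf-neighbour-unique : ∀ i {b w} → G (leaf T i) b ≡ true → G (leaf T i) w ≡ true → w ≡ b
  leaf-neighbour-unique i {b} {w} ib iw with w ≟ᶠ b
  ... | yes w≡b = w≡b
  ... | no w≢b  = contradiction (≤-trans (two-neighbours⇒2≤degree iw ib w≢b) (leaf-deg T i)) λ { (s≤s ()) }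

  two-neighbours⇒degree-3 : ∀ {x y z} → G x y ≡ true → G x z ≡ true → y ≢ z → degree G x ≡ 3
  two-neighbours⇒degree-3 {x} xy xz y≢z with internal T x
  ... | inj₁ deg≡3      = deg≡3
  ... | inj₂ (i , refl) = contradiction (leaf-neighbour-unique i xy xz) (y≢z ∘ ≡-sym)

  -- The leaf ℓ lies beyond x as seen from y: a non-backtracking walk leads
  -- from x to ℓ without first stepping to y.
  LeafBeyond : V → V → Fin n → Set
  LeafBeyond y x ℓ = ∃ λ k → Σ (Walk G x (leaf T ℓ) k) λ p → FirstStepAvoids y p × NonBacktracking p

  -- The walk taken so far (the reversed trail, starting at z)
  -- is non-backtracking, hence a path with fewer than m edges; the fuel
  -- bounds the number of further steps this allows.
  walk-to-leaf : (fuel : ℕ) → ∀ {z prev s j} (z-prev : G z prev ≡ true) (trail : Walk G prev s j) →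
                 NonBacktracking (step z-prev trail) → m T ≤ fuel + suc j → ∃ (LeafBeyond prev z)
  walk-to-leaf zero z-prev trail trail-nb m≤j+1 =
    contradiction (≤-trans (path-length<m walked (nonBacktracking⇒path walked trail-nb)) m≤j+1) (<-irrefl refl)
    where
      walked : Walk G _ _ _
      walked = step z-prev trail
  walk-to-leaf (suc fuel) {z} {prev} {j = j} z-prev trail trail-nb m≤fuel+j+2 with internal T z
  ... | inj₂ (ℓ , refl) = ℓ , 0 , here , tt , tt
  ... | inj₁ deg≡3
    with t , z-t , t≢prev , _ ← third-neighbour deg≡3 prev prev
    with ℓ , k , p , z-avoids , p-nb ←
           walk-to-leaf fuel (trans (sym T t z) z-t) (step z-prev trail) (t≢prev , trail-nb)
                        (subst (m T ≤_) (≡-sym (+-suc fuel (suc j))) m≤fuel+j+2)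
    = ℓ , suc k , step z-t p , t≢prev ∘ ≡-sym , z-avoids , p-nb

  leaf-beyond : ∀ {x w} → G w x ≡ true → ∃ (LeafBeyond x w)
  leaf-beyond wx = walk-to-leaf (m T) wx here (tt , tt) (m≤m+n (m T) 1)

  -- Following a non-backtracking walk p from x to the leaf b, entered from y,
  -- yields k + 1 distinct leaves beyond x as seen from y: one beyond the third
  -- neighbour of each inner vertex of p, and b itself.  They are distinct
  -- because non-backtracking walks with the same ends take the same first step.
  leaves-beyond : ∀ {y x k} (b : Fin n) → G y x ≡ true → (p : Walk G x (leaf T b) k) →
                  FirstStepAvoids y p → NonBacktracking p →
                  ∃ λ ls → length ls ≡ suc k × Unique ls × All (LeafBeyond y x) ls
  leaves-beyond b yx here _ _ = b ∷ [] , refl , [] ∷ [] , (0 , here , tt , tt) ∷ []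
  leaves-beyond {y} {x} b yx (step {w = x′} xx′ p) y≢x′ (x-avoids , p-nb)
    with w , xw , w≢y , w≢x′ ← third-neighbour (two-neighbours⇒degree-3 (trans (sym T x y) yx) xx′ y≢x′) y x′
    with ℓ , k , q , x-avoids-q , q-nb ← leaf-beyond (trans (sym T w x) xw)
    with ls , length-ls , ls-unique , ls-beyond ← leaves-beyond b xx′ p x-avoids p-nb
    = ℓ ∷ ls , cong suc length-ls , All.tabulate ℓ∉ls ∷ ls-unique
    , (suc k , step xw q , w≢y ∘ ≡-sym , x-avoids-q , q-nb) ∷ All.map extend ls-beyond
    where
      extend : ∀ {ℓ′} → LeafBeyond x x′ ℓ′ → LeafBeyond y x ℓ′
      extend (k′ , q′ , x-avoids-q′ , q′-nb) = suc k′ , step xx′ q′ , y≢x′ , x-avoids-q′ , q′-nb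

      ℓ∉ls : ∀ {ℓ′} → ℓ′ ∈ ls → ℓ ≢ ℓ′
      ℓ∉ls ℓ′∈ls refl with k′ , q′ , x-avoids-q′ , q′-nb ← All.lookup ls-beyond ℓ′∈ls =
        w≢x′ (same-first-step xw q xx′ q′ (x-avoids-q , q-nb) (x-avoids-q′ , q′-nb))

  -- A path between two leaves with d edges passes d + 1 distinct leaves: its
  -- start and those found by leaves-beyond.  Hence d < n.
  leaf-path-length<n : ∀ {d} (A B : Fin n) (p : Walk G (leaf T A) (leaf T B) d) → IsPath p → suc d ≤ n
  leaf-path-length<n {zero} A _ _ _ = taxa-nonempty A
    where
      taxa-nonempty : ∀ {k} → Fin k → 1 ≤ k
      taxa-nonempty {suc _} _ = s≤s z≤n
  leaf-path-length<n {suc d} A B (step Ax p) p-path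
    with A-avoids , p-nb ← path⇒nonBacktracking (step Ax p) p-path
    with ls , length-ls , ls-unique , ls-beyond ← leaves-beyond B Ax p A-avoids p-nb =
    subst₂ _≤_ (cong suc length-ls) (length-allFin _)
      (unique-⊆⇒length-≤ (All.tabulate A∉ls ∷ ls-unique) (λ {z} _ → ∈-allFin z))
    where
      -- a non-backtracking walk from the neighbour of A back to A would close a cycle
      A∉ls : ∀ {ℓ} → ℓ ∈ ls → A ≢ ℓ
      A∉ls ℓ∈ls refl with k , q , A-avoids-q , q-nb ← All.lookup ls-beyond ℓ∈ls =
        contradiction (closed-path-trivial (step Ax q) (nonBacktracking⇒path (step Ax q) (A-avoids-q , q-nb)))
                      λ ()

  distinct-taxa⇒1≤distance : ∀ {A B d} → A ≢ B → Walk G (leaf T A) (leaf T B) d → 1 ≤ d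
  distinct-taxa⇒1≤distance A≢B = distinct⇒1≤length (A≢B ∘ leaf-inj T)

  -- No walk leaves a pair of adjacent leaves, each being the other's only neighbour.
  adjacent-leaves-isolated : ∀ {A B} → G (leaf T A) (leaf T B) ≡ true → ∀ {s z k} → Walk G s z k →
                             s ≡ leaf T A ⊎ s ≡ leaf T B → z ≡ leaf T A ⊎ z ≡ leaf T B
  adjacent-leaves-isolated AB here s∈AB = s∈AB
  adjacent-leaves-isolated {A} AB (step e p) (inj₁ refl) =
    adjacent-leaves-isolated AB p (inj₂ (leaf-neighbour-unique A AB e))
  adjacent-leaves-isolated {A} {B} AB (step e p) (inj₂ refl) =
    adjacent-leaves-isolated AB p (inj₁ (leaf-neighbour-unique B (trans (sym T (leaf T B) (leaf T A)) AB) e))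

  -- If there is a third taxon C, the leaves of distinct taxa A and B are not
  -- adjacent, since C would be unreachable from A.
  third-taxon⇒2≤distance : ∀ {A B C d} → A ≢ B → C ≢ A → C ≢ B → Walk G (leaf T A) (leaf T B) d → 2 ≤ d
  third-taxon⇒2≤distance {d = zero} A≢B _ _ p = contradiction (distinct-taxa⇒1≤distance A≢B p) λ ()
  third-taxon⇒2≤distance {A} {B} {C} {d = 1} _ C≢A C≢B p
    with _ , A⇝C ← connected T (leaf T A) (leaf T C)
    with adjacent-leaves-isolated (walk-of-length-1 p) A⇝C (inj₁ refl)
  ... | inj₁ C≡A = contradiction (leaf-inj T C≡A) C≢A
  ... | inj₂ C≡B = contradiction (leaf-inj T C≡B) C≢B
  third-taxon⇒2≤distance {d = suc (suc _)} _ _ _ _ = s≤s (s≤s z≤n)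

open Tree using (leaf-path-length<n; distinct-taxa⇒1≤distance; third-taxon⇒2≤distance)
open Walks using (closed-path-trivial)

∣-∣≤width : ∀ l {k x y} → l ≤ x → x ≤ l + k → l ≤ y → y ≤ l + k → ∣ x - y ∣ ≤ k
∣-∣≤width zero {x = x} {y} _ x≤k _ y≤k = ≤-trans (∣m-n∣≤m⊔n x y) (⊔-lub x≤k y≤k)
∣-∣≤width (suc l) (s≤s l≤x) (s≤s x≤l+k) (s≤s l≤y) (s≤s y≤l+k) = ∣-∣≤width l l≤x x≤l+k l≤y y≤l+k

third-taxon : ∀ {k} (A B : Fin (3 + k)) → ∃ λ C → C ≢ A × C ≢ B
third-taxon {k} A B with C , _ , C≢A , C≢B ←
  avoid-two _≟ᶠ_ (allFin⁺ (3 + k)) (subst (3 ≤_) (≡-sym (length-allFin (3 + k))) (s≤s (s≤s (s≤s z≤n)))) A B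
  = C , C≢A , C≢B

lemma1 : (n : ℕ) (T₁ T₂ : UnrootedBinaryTree n) → IC (n ∸ 3) T₁ T₂
lemma1 n T₁ T₂ A B d₁ d₂ (p₁ , p₁-path) (p₂ , p₂-path) with A ≟ᶠ B
... | yes refl rewrite closed-path-trivial p₁ p₁-path | closed-path-trivial p₂ p₂-path = z≤n
lemma1 (suc zero) T₁ T₂ Fin.zero Fin.zero d₁ d₂ _ _ | no 0≢0 = contradiction refl 0≢0
lemma1 (suc (suc zero)) T₁ T₂ A B d₁ d₂ (p₁ , p₁-path) (p₂ , p₂-path) | no A≢B =
  ∣-∣≤width 1 (distinct-taxa⇒1≤distance T₁ A≢B p₁) (s≤s⁻¹ (leaf-path-length<n T₁ A B p₁ p₁-path))
              (distinct-taxa⇒1≤distance T₂ A≢B p₂) (s≤s⁻¹ (leaf-path-length<n T₂ A B p₂ p₂-path))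
lemma1 (suc (suc (suc k))) T₁ T₂ A B d₁ d₂ (p₁ , p₁-path) (p₂ , p₂-path) | no A≢B
  with C , C≢A , C≢B ← third-taxon A B =
  ∣-∣≤width 2 (third-taxon⇒2≤distance T₁ A≢B C≢A C≢B p₁) (s≤s⁻¹ (leaf-path-length<n T₁ A B p₁ p₁-path))
              (third-taxon⇒2≤distance T₂ A≢B C≢A C≢B p₂) (s≤s⁻¹ (leaf-path-length<n T₂ A B p₂ p₂-path))
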